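{- Let $P$ be a finite poset with a unique minimal element $\hat{0}$ and Möbius function $\mu$, and let $\sim$ be an equivalence relation on $P$ such that $P/\sim$ is a homogeneous quotient. Suppose that for every equivalence class $X$ that is neither maximal in $P/\sim$ nor equal to $\{\hat{0}\}$, $\sum_{y\in L(X)}\mu(y)=0$, where $L(X)$ is the lower order ideal of $P$ generated by $X$. Then for every $X\in P/\sim$, $$\mu(X)=\begin{cases}\sum_{x\in X}\mu(x) & \text{if } X \text{ is not maximal},\\ \sum_{x\in X}\mu(x)-\sum_{y\in L(X)}\mu(y) & \text{if } X \text{ is maximal},\end{cases}$$ where $\mu(X)$ is the Möbius function of $P/\sim$.
   Context: The Möbius function of a finite poset with minimum $\hat{0}$ is defined by $\sum_{y\leq x}\mu(y)=\delta_{\hat{0},x}$. For an equivalence relation $\sim$ on $P$, the quotient $P/\sim$ is the set of equivalence classes with $X\leq Y$ iff $x\leq y$ in $P$ for some $x\in X$, $y\in Y$. It is a homogeneous quotient if (1) $\{\hat{0}\}$ is an equivalence class, and (2) whenever $X\leq Y$, for every $x\in X$ there is $y\in Y$ with $x\leq y$; then $P/\sim$ is a poset with minimum $\{\hat{0}\}$. -}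

module Defs where

open import Level using (0ℓ)
open import Data.Bool using (if_then_else_)
open import Data.Nat as ℕ using (ℕ)
open import Data.Fin using (Fin; zero; suc; toℕ)
open import Data.Fin.Properties using (any?; all?)
open import Data.Integer using (ℤ; _+_; _-_; 0ℤ; 1ℤ)
open import Data.Product using (Σ; ∃; _×_; _,_)
open import Relation.Nullary using (¬_; Dec; does)
open import Relation.Nullary.Decidable using (_×-dec_; _→-dec_)
open import Relation.Binary using (Rel; Decidable; IsDecPartialOrder; IsDecEquivalence)
open import Relation.Binary.PropositionalEquality using (_≡_)
open import Function using (_∘_)

sumFin : ∀ {n} → (Fin n → ℤ) → ℤ
sumFin {ℕ.zero} f = 0ℤ
sumFin {ℕ.suc n} f = f zero + sumFin (f ∘ suc)

sumWhere : ∀ {n} {P : Fin n → Set} → (∀ i → Dec (P i)) → (Fin n → ℤ) → ℤ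
sumWhere P? f = sumFin (λ i → if does (P? i) then f i else 0ℤ)

δ : ∀ {A : Set} → Dec A → ℤ
δ d = if does d then 1ℤ else 0ℤ

-- A finite poset P = (Fin n, _≤_) with an equivalence relation _~_ on it,
-- and a distinguished element z (intended to be the minimum 0̂).
module QuotientDefs {n : ℕ}
  (_≤_ : Rel (Fin n) 0ℓ) (isPO : IsDecPartialOrder _≡_ _≤_)
  (_~_ : Rel (Fin n) 0ℓ) (isEq : IsDecEquivalence _~_)
  (z : Fin n) where

  open IsDecPartialOrder isPO using (_≤?_; _≟_)
  open IsDecEquivalence isEq using () renaming (_≟_ to _~?_)

  IsMinimum : Set
  IsMinimum = ∀ x → z ≤ x

  IsMobius : (Fin n → ℤ) → Set
  IsMobius μ = ∀ x → sumWhere (λ y → y ≤? x) μ ≡ δ (x ≟ z)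

  -- Equivalence classes are represented by their elements; the class of a
  -- is [a] = { x | x ~ a }.  Order of P/~ : [a] ≤ [b] iff x ≤ y for some
  -- x ~ a, y ~ b.
  QLe : Fin n → Fin n → Set
  QLe a b = ∃ λ x → ∃ λ y → (x ~ a) × (y ~ b) × (x ≤ y)

  QLe? : ∀ a b → Dec (QLe a b)
  QLe? a b = any? (λ x → any? (λ y → (x ~? a) ×-dec ((y ~? b) ×-dec (x ≤? y))))

  IsHomogeneous : Set
  IsHomogeneous =
    (∀ x → x ~ z → x ≡ z) ×
    (∀ a b → QLe a b → ∀ x → x ~ a → ∃ λ y → (y ~ b) × (x ≤ y))

  -- a is the canonical representative of its class (least index in it);
  -- used to sum over the classes of P/~, each class counted once.
  Canon : Fin n → Set
  Canon a = ∀ b → b ~ a → toℕ a ℕ.≤ toℕ b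

  Canon? : ∀ a → Dec (Canon a)
  Canon? a = all? (λ b → (b ~? a) →-dec (toℕ a ℕ.≤? toℕ b))

  -- Möbius function of P/~, as a function of a representative:
  -- well defined on classes and Σ_{Y ≤ X} μQ(Y) = δ_{{0̂},X}.
  IsQuotientMobius : (Fin n → ℤ) → Set
  IsQuotientMobius μQ =
    (∀ a b → a ~ b → μQ a ≡ μQ b) ×
    (∀ a → sumWhere (λ b → Canon? b ×-dec QLe? b a) μQ ≡ δ (a ~? z))

  Maximal : Fin n → Set
  Maximal a = ∀ b → QLe a b → b ~ a

  InL : Fin n → Fin n → Set
  InL a y = ∃ λ x → (x ~ a) × (y ≤ x)

  InL? : ∀ a y → Dec (InL a y)
  InL? a y = any? (λ x → (x ~? a) ×-dec (y ≤? x))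

  LSum : (Fin n → ℤ) → Fin n → ℤ
  LSum μ a = sumWhere (InL? a) μ

  ClassSum : (Fin n → ℤ) → Fin n → ℤ
  ClassSum μ a = sumWhere (λ x → x ~? a) μ

-- Put M(X) = Σ_{y ∈ L(X)} μ(y) if X is maximal and M(X) = 0 otherwise.  Homogeneity makes
-- every x ∈ L(X) lie below exactly one class Y ≤ X, so Σ_{Y ≤ X} Σ_{x ∈ Y} μ(x) = Σ_{L(X)} μ;
-- and a maximal class below X is X itself, so Σ_{Y ≤ X} M(Y) = M(X).  With the hypothesis
-- this gives Σ_{Y ≤ X} (μ(Y) + M(Y)) = δ_{{0̂},X} + M(X) = Σ_{Y ≤ X} Σ_{x ∈ Y} μ(x), and
-- Möbius inversion on the finite poset P/∼ yields μ(X) + M(X) = Σ_{x ∈ X} μ(x).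
module Submission where

open import Defs
open import Level using (0ℓ)
open import Data.Bool using (if_then_else_)
open import Data.Nat as ℕ using (ℕ; zero; suc; z≤n; s≤s)
import Data.Nat.Properties as ℕ
open import Data.Fin using (Fin; toℕ; punchIn) renaming (zero to fzero; suc to fsuc)
open import Data.Fin.Properties using (any?; all?; toℕ-injective; punchInᵢ≢i)
open import Data.Fin.Induction using (po-wellFounded; po-noetherian)
open import Data.Integer using (ℤ; _+_; _-_; 0ℤ; 1ℤ)
import Data.Integer.Properties as ℤ
open import Data.Product using (∃; _×_; _,_; proj₁; proj₂)
open import Data.Empty using (⊥-elim)
open import Function using (_∘_; flip)
open import Induction.WellFounded using (Acc; acc; WellFounded; module All)
open import Relation.Nullary using (¬_; Dec; yes; no; does; ¬?)
open import Relation.Nullary.Decidable using (_×-dec_; _→-dec_; decidable-stable)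
open import Relation.Binary
  using (Rel; IsDecPartialOrder; IsDecEquivalence; IsPartialOrder; Transitive; Antisymmetric)
open import Relation.Binary.PropositionalEquality
  using (_≡_; _≢_; _≗_; refl; sym; trans; cong; cong₂; subst; module ≡-Reasoning)
import Relation.Binary.Construct.NonStrictToStrict as ToStrict
open import Algebra.Bundles using (AbelianGroup)
open import Algebra.Properties.CommutativeMonoid.Sum ℤ.+-0-commutativeMonoid
  using (sum; sum-cong-≗; sum-replicate-zero; sum-remove; ∑-distrib-+; ∑-comm)
open import Algebra.Properties.Group (AbelianGroup.group ℤ.+-0-abelianGroup)
  using (∙-cancelʳ; //-rightDividesʳ)

open ≡-Reasoning

sumFin≡sum : ∀ {n} (f : Fin n → ℤ) → sumFin f ≡ sum f
sumFin≡sum {zero} f = refl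
sumFin≡sum {suc n} f = cong (f fzero +_) (sumFin≡sum (f ∘ fsuc))

sumFin-cong : ∀ {n} {f g : Fin n → ℤ} → f ≗ g → sumFin f ≡ sumFin g
sumFin-cong {f = f} {g} f≗g = begin
  sumFin f ≡⟨ sumFin≡sum f ⟩
  sum f    ≡⟨ sum-cong-≗ f≗g ⟩
  sum g    ≡⟨ sumFin≡sum g ⟨
  sumFin g ∎

sumFin-zero : ∀ {n} {f : Fin n → ℤ} → (∀ i → f i ≡ 0ℤ) → sumFin f ≡ 0ℤ
sumFin-zero {n} f≗0 =
  trans (sumFin-cong f≗0) (trans (sumFin≡sum {n} (λ _ → 0ℤ)) (sum-replicate-zero n))

sumFin-+ : ∀ {n} (f g : Fin n → ℤ) → sumFin (λ i → f i + g i) ≡ sumFin f + sumFin g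
sumFin-+ f g = begin
  sumFin (λ i → f i + g i) ≡⟨ sumFin≡sum (λ i → f i + g i) ⟩
  sum (λ i → f i + g i)    ≡⟨ ∑-distrib-+ f g ⟩
  sum f + sum g            ≡⟨ cong₂ _+_ (sumFin≡sum f) (sumFin≡sum g) ⟨
  sumFin f + sumFin g      ∎

sumFin-comm : ∀ {m n} (F : Fin m → Fin n → ℤ) →
  sumFin (λ i → sumFin (F i)) ≡ sumFin (λ j → sumFin (λ i → F i j))
sumFin-comm F = trans (sumFin²≡sum² F) (trans (∑-comm F) (sym (sumFin²≡sum² (flip F))))
  where
  sumFin²≡sum² : ∀ {m n} (G : Fin m → Fin n → ℤ) →
    sumFin (λ i → sumFin (G i)) ≡ sum (λ i → sum (G i))
  sumFin²≡sum² G = trans (sumFin≡sum (λ i → sumFin (G i))) (sum-cong-≗ (sumFin≡sum ∘ G))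

sumFin-only : ∀ {n} {f : Fin n → ℤ} (c : Fin n) → (∀ i → i ≢ c → f i ≡ 0ℤ) → sumFin f ≡ f c
sumFin-only {suc n} {f} c vanish = begin
  sumFin f                   ≡⟨ sumFin≡sum f ⟩
  sum f                      ≡⟨ sum-remove {i = c} f ⟩
  f c + sum (f ∘ punchIn c)  ≡⟨ cong (f c +_) rest≡0 ⟩
  f c + 0ℤ                   ≡⟨ ℤ.+-identityʳ (f c) ⟩
  f c                        ∎
  where
  rest≡0 : sum (f ∘ punchIn c) ≡ 0ℤ
  rest≡0 = trans (sym (sumFin≡sum (f ∘ punchIn c)))
    (sumFin-zero (λ j → vanish (punchIn c j) (punchInᵢ≢i c j)))

sumFin-cancel : ∀ {n} {f g : Fin n → ℤ} (c : Fin n) →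
  (∀ i → i ≢ c → f i ≡ g i) → sumFin f ≡ sumFin g → f c ≡ g c
sumFin-cancel {suc n} {f} {g} c agree sums≡ =
  ∙-cancelʳ (sum (g ∘ punchIn c)) (f c) (g c) (begin
    f c + sum (g ∘ punchIn c) ≡⟨ cong (f c +_) rests≡ ⟨
    f c + sum (f ∘ punchIn c) ≡⟨ sum-remove {i = c} f ⟨
    sum f                     ≡⟨ trans (sym (sumFin≡sum f)) (trans sums≡ (sumFin≡sum g)) ⟩
    sum g                     ≡⟨ sum-remove {i = c} g ⟩
    g c + sum (g ∘ punchIn c) ∎)
  where
  rests≡ : sum (f ∘ punchIn c) ≡ sum (g ∘ punchIn c)
  rests≡ = sum-cong-≗ (λ j → agree (punchIn c j) (punchInᵢ≢i c j))

select : ∀ {A : Set} → Dec A → ℤ → ℤ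
select d u = if does d then u else 0ℤ

select-yes : ∀ {A : Set} (d : Dec A) {u : ℤ} → A → select d u ≡ u
select-yes (yes _) _ = refl
select-yes (no ¬a) a = ⊥-elim (¬a a)

select-no : ∀ {A : Set} (d : Dec A) {u : ℤ} → ¬ A → select d u ≡ 0ℤ
select-no (yes a) ¬a = ⊥-elim (¬a a)
select-no (no _) _ = refl

select-congʳ : ∀ {A : Set} (d : Dec A) {u v : ℤ} → (A → u ≡ v) → select d u ≡ select d v
select-congʳ (yes a) u≡v = u≡v a
select-congʳ (no _) _ = refl

select-zero : ∀ {A : Set} (d : Dec A) {u : ℤ} → (A → u ≡ 0ℤ) → select d u ≡ 0ℤ
select-zero (yes a) u≡0 = u≡0 a
select-zero (no _) _ = refl

select-cong : ∀ {A B : Set} (dA : Dec A) (dB : Dec B) {u : ℤ} →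
  (A → B) → (B → A) → select dA u ≡ select dB u
select-cong dA dB A⇒B B⇒A with dA | dB
... | yes _ | yes _ = refl
... | no _  | no _  = refl
... | yes a | no ¬b = ⊥-elim (¬b (A⇒B a))
... | no ¬a | yes b = ⊥-elim (¬a (B⇒A b))

select-+ : ∀ {A : Set} (d : Dec A) (u v : ℤ) → select d (u + v) ≡ select d u + select d v
select-+ (yes _) u v = refl
select-+ (no _) u v = refl

select-sumFin : ∀ {A : Set} (d : Dec A) {n} (g : Fin n → ℤ) →
  select d (sumFin g) ≡ sumFin (λ i → select d (g i))
select-sumFin (yes _) g = refl
select-sumFin (no ¬a) g = sym (sumFin-zero {f = λ i → select (no ¬a) (g i)} (λ _ → refl))

module _ {n} {P Q : Fin n → Set} (P? : ∀ i → Dec (P i)) (Q? : ∀ i → Dec (Q i)) where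

  sumWhere-cong : (∀ i → P i → Q i) → (∀ i → Q i → P i) → (f : Fin n → ℤ) →
    sumWhere P? f ≡ sumWhere Q? f
  sumWhere-cong P⇒Q Q⇒P f = sumFin-cong (λ i → select-cong (P? i) (Q? i) (P⇒Q i) (Q⇒P i))

sumWhere-+ : ∀ {n} {P : Fin n → Set} (P? : ∀ i → Dec (P i)) (f g : Fin n → ℤ) →
  sumWhere P? (λ i → f i + g i) ≡ sumWhere P? f + sumWhere P? g
sumWhere-+ P? f g = trans (sumFin-cong (λ i → select-+ (P? i) (f i) (g i)))
  (sumFin-+ (λ i → select (P? i) (f i)) (λ i → select (P? i) (g i)))

leastIndex : ∀ {n} {S : Fin n → Set} → (∀ i → Dec (S i)) → ∀ {x} → S x →
  ∃ λ m → S m × (∀ b → S b → toℕ m ℕ.≤ toℕ b)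
leastIndex {suc n} S? {x} sx with S? fzero
... | yes s0 = fzero , s0 , λ _ _ → z≤n
leastIndex {suc n} S? {fzero} sx | no ¬s0 = ⊥-elim (¬s0 sx)
leastIndex {suc n} {S} S? {fsuc x} sx | no ¬s0 with leastIndex (S? ∘ fsuc) sx
... | m , sm , least = fsuc m , sm , least′
  where
  least′ : ∀ b → S b → toℕ (fsuc m) ℕ.≤ toℕ b
  least′ fzero sb = ⊥-elim (¬s0 sb)
  least′ (fsuc b) sb = s≤s (least b sb)

module _ {n} {_≤_ : Rel (Fin n) 0ℓ} (isPO : IsDecPartialOrder _≡_ _≤_) where

  open IsDecPartialOrder isPO using (_≤?_; _≟_; isPartialOrder)

  maximalElement : {S : Fin n → Set} → (∀ i → Dec (S i)) → ∀ {x} → S x →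
    ∃ λ m → S m × (∀ y → S y → m ≤ y → y ≡ m)
  maximalElement {S} S? {x} sx = go (po-noetherian isPartialOrder x) sx
    where
    go : ∀ {x} → Acc (flip (ToStrict._<_ _≡_ _≤_)) x → S x →
      ∃ λ m → S m × (∀ y → S y → m ≤ y → y ≡ m)
    go {x} (acc above) sx with any? (λ y → S? y ×-dec ((x ≤? y) ×-dec ¬? (x ≟ y)))
    ... | yes (y , sy , x<y) = go (above x<y) sy
    ... | no none = x , sx , λ y sy x≤y →
      decidable-stable (y ≟ x) (λ y≢x → none (y , sy , x≤y , y≢x ∘ sym))

module HomogeneousQuotient {n : ℕ}
  (_≤_ : Rel (Fin n) 0ℓ) (isPO : IsDecPartialOrder _≡_ _≤_)
  (_~_ : Rel (Fin n) 0ℓ) (isEq : IsDecEquivalence _~_)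
  (z : Fin n) (homogeneous : QuotientDefs.IsHomogeneous _≤_ isPO _~_ isEq z) where

  open QuotientDefs _≤_ isPO _~_ isEq z
  open IsDecPartialOrder isPO using (_≤?_; _≟_)
    renaming (refl to ≤-refl; trans to ≤-trans; antisym to ≤-antisym)
  open IsDecEquivalence isEq using (isEquivalence)
    renaming (_≟_ to _~?_; refl to ~-refl; sym to ~-sym; trans to ~-trans)

  zero-class : ∀ {x} → x ~ z → x ≡ z
  zero-class = proj₁ homogeneous _

  lift : ∀ {a b} → QLe a b → ∀ {x} → x ~ a → ∃ λ y → (y ~ b) × (x ≤ y)
  lift q x~a = proj₂ homogeneous _ _ q _ x~a

  QLe-reflexive : ∀ {a b} → a ~ b → QLe a b
  QLe-reflexive {a} a~b = a , a , ~-refl , a~b , ≤-refl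

  QLe-trans : Transitive QLe
  QLe-trans (x , y , x~a , y~b , x≤y) b≤c with lift b≤c y~b
  ... | y′ , y′~c , y≤y′ = x , y′ , x~a , y′~c , ≤-trans x≤y y≤y′

  -- Compare a maximal element m of the class [a] with what lies above it in [b] and back in [a].
  QLe-antisym : Antisymmetric _~_ QLe
  QLe-antisym {a} {b} a≤b b≤a with maximalElement isPO (_~? a) (~-refl {a})
  ... | m , m~a , m-max with lift a≤b m~a
  ... | y , y~b , m≤y with lift b≤a y~b
  ... | m′ , m′~a , y≤m′ = ~-trans (~-sym m~a) (subst (_~ b) y≡m y~b)
    where
    m′≡m : m′ ≡ m
    m′≡m = m-max m′ m′~a (≤-trans m≤y y≤m′)
    y≡m : y ≡ m
    y≡m = ≤-antisym (subst (y ≤_) m′≡m y≤m′) m≤y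

  QLe-isPartialOrder : IsPartialOrder _~_ QLe
  QLe-isPartialOrder = record
    { isPreorder = record
      { isEquivalence = isEquivalence ; reflexive = QLe-reflexive ; trans = QLe-trans }
    ; antisym = QLe-antisym
    }

  _⊏_ : Rel (Fin n) 0ℓ
  _⊏_ = ToStrict._<_ _~_ QLe

  ⊏-wellFounded : WellFounded _⊏_
  ⊏-wellFounded = po-wellFounded QLe-isPartialOrder

  canonical : ∀ x → ∃ λ c → (c ~ x) × Canon c
  canonical x with leastIndex (_~? x) (~-refl {x})
  ... | c , c~x , least = c , c~x , λ b b~c → least b (~-trans b~c c~x)

  canon : Fin n → Fin n
  canon x = proj₁ (canonical x)

  canon~ : ∀ x → canon x ~ x
  canon~ x = proj₁ (proj₂ (canonical x))

  canon-Canon : ∀ x → Canon (canon x)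
  canon-Canon x = proj₂ (proj₂ (canonical x))

  Canon⇒≡canon : ∀ {b a} → Canon b → b ~ a → b ≡ canon a
  Canon⇒≡canon {b} {a} cb b~a = toℕ-injective (ℕ.≤-antisym
    (cb (canon a) (~-trans (canon~ a) (~-sym b~a)))
    (canon-Canon a b (~-trans b~a (~-sym (canon~ a)))))

  Invariant : (Fin n → ℤ) → Set
  Invariant g = ∀ {a b} → a ~ b → g a ≡ g b

  CanonBelow? : ∀ a b → Dec (Canon b × QLe b a)
  CanonBelow? a b = Canon? b ×-dec QLe? b a

  LowerSum : (Fin n → ℤ) → Fin n → ℤ
  LowerSum g a = sumWhere (CanonBelow? a) g

  LowerSum-injective : ∀ {f g} → Invariant f → Invariant g →
    (∀ a → LowerSum f a ≡ LowerSum g a) → ∀ a → f a ≡ g a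
  LowerSum-injective {f} {g} f-inv g-inv sums≡ = All.wfRec ⊏-wellFounded 0ℓ _ step
    where
    step : ∀ a → (∀ {b} → b ⊏ a → f b ≡ g b) → f a ≡ g a
    step a below = begin
      f a                           ≡⟨ f-inv (canon~ a) ⟨
      f (canon a)                   ≡⟨ select-yes (CQ (canon a)) canon-below ⟨
      select (CQ (canon a)) (f (canon a))
        ≡⟨ sumFin-cancel (canon a) agree (sums≡ a) ⟩
      select (CQ (canon a)) (g (canon a)) ≡⟨ select-yes (CQ (canon a)) canon-below ⟩
      g (canon a)                   ≡⟨ g-inv (canon~ a) ⟩
      g a                           ∎
      where
      CQ = CanonBelow? a
      canon-below : Canon (canon a) × QLe (canon a) a
      canon-below = canon-Canon a , QLe-reflexive (canon~ a)
      agree : ∀ b → b ≢ canon a → select (CQ b) (f b) ≡ select (CQ b) (g b)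
      agree b b≢ca = select-congʳ (CQ b) (λ (cb , b≤a) → below (b≤a , b≢ca ∘ Canon⇒≡canon cb))

  ClassSum-invariant : ∀ μ → Invariant (ClassSum μ)
  ClassSum-invariant μ {a} {b} a~b =
    sumWhere-cong (_~? a) (_~? b) (λ _ x~a → ~-trans x~a a~b) (λ _ x~b → ~-trans x~b (~-sym a~b)) μ

  InL-resp : ∀ {a b y} → a ~ b → InL a y → InL b y
  InL-resp a~b (x , x~a , y≤x) = x , ~-trans x~a a~b , y≤x

  LSum-invariant : ∀ μ → Invariant (LSum μ)
  LSum-invariant μ {a} {b} a~b =
    sumWhere-cong (InL? a) (InL? b) (λ _ → InL-resp a~b) (λ _ → InL-resp (~-sym a~b)) μ

  -- Homogeneity: x ∈ L([a]) exactly when the class of x lies below [a].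
  LowerSum-ClassSum : ∀ μ a → LowerSum (ClassSum μ) a ≡ LSum μ a
  LowerSum-ClassSum μ a = begin
    sumFin (λ b → select (CQ b) (sumFin (λ x → select (x ~? b) (μ x))))
      ≡⟨ sumFin-cong (λ b → select-sumFin (CQ b) (λ x → select (x ~? b) (μ x))) ⟩
    sumFin (λ b → sumFin (λ x → select (CQ b) (select (x ~? b) (μ x))))
      ≡⟨ sumFin-comm (λ b x → select (CQ b) (select (x ~? b) (μ x))) ⟩
    sumFin (λ x → sumFin (λ b → select (CQ b) (select (x ~? b) (μ x))))
      ≡⟨ sumFin-cong only-class-of-x ⟩
    sumFin (λ x → select (InL? a x) (μ x)) ∎
    where
    CQ = CanonBelow? a
    only-class-of-x : ∀ x →
      sumFin (λ b → select (CQ b) (select (x ~? b) (μ x))) ≡ select (InL? a x) (μ x)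
    only-class-of-x x = begin
      sumFin (λ b → select (CQ b) (select (x ~? b) (μ x))) ≡⟨ sumFin-only (canon x) vanish ⟩
      select (CQ (canon x)) (select (x ~? canon x) (μ x))
        ≡⟨ cong (select (CQ (canon x))) (select-yes (x ~? canon x) (~-sym (canon~ x))) ⟩
      select (CQ (canon x)) (μ x)  ≡⟨ select-cong (CQ (canon x)) (InL? a x) to from ⟩
      select (InL? a x) (μ x)      ∎
      where
      vanish : ∀ b → b ≢ canon x → select (CQ b) (select (x ~? b) (μ x)) ≡ 0ℤ
      vanish b b≢cx = select-zero (CQ b) (λ (cb , _) →
        select-no (x ~? b) (λ x~b → b≢cx (Canon⇒≡canon cb (~-sym x~b))))
      to : Canon (canon x) × QLe (canon x) a → InL a x
      to (_ , cx≤a) = lift cx≤a (~-sym (canon~ x))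
      from : InL a x → Canon (canon x) × QLe (canon x) a
      from (y , y~a , x≤y) = canon-Canon x , x , y , ~-sym (canon~ x) , y~a , x≤y

  Maximal? : ∀ a → Dec (Maximal a)
  Maximal? a = all? (λ c → QLe? a c →-dec (c ~? a))

  Maximal-resp : ∀ {a b} → a ~ b → Maximal a → Maximal b
  Maximal-resp a~b max-a c b≤c =
    ~-trans (max-a c (QLe-trans (QLe-reflexive a~b) b≤c)) a~b

  LowerSum-maximal : ∀ {h} → Invariant h → (∀ b → ¬ Maximal b → h b ≡ 0ℤ) →
    ∀ a → LowerSum h a ≡ h a
  LowerSum-maximal {h} h-inv supported a = begin
    LowerSum h a ≡⟨ sumFin-only (canon a) vanish ⟩
    select (CanonBelow? a (canon a)) (h (canon a))
      ≡⟨ select-yes (CanonBelow? a (canon a)) (canon-Canon a , QLe-reflexive (canon~ a)) ⟩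
    h (canon a)  ≡⟨ h-inv (canon~ a) ⟩
    h a          ∎
    where
    vanish : ∀ b → b ≢ canon a → select (CanonBelow? a b) (h b) ≡ 0ℤ
    vanish b b≢ca = select-zero (CanonBelow? a b) (λ (cb , b≤a) →
      supported b (λ max-b → b≢ca (Canon⇒≡canon cb (~-sym (max-b a b≤a)))))

  LSum-zero : ∀ μ → IsMobius μ → LSum μ z ≡ 1ℤ
  LSum-zero μ isMobius = begin
    LSum μ z                   ≡⟨ sumWhere-cong (InL? z) (_≤? z) below-z at-z μ ⟩
    sumWhere (_≤? z) μ         ≡⟨ isMobius z ⟩
    δ (z ≟ z)                  ≡⟨ select-yes (z ≟ z) refl ⟩
    1ℤ                         ∎
    where
    below-z : ∀ y → InL z y → y ≤ z
    below-z y (x , x~z , y≤x) = subst (y ≤_) (zero-class x~z) y≤x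
    at-z : ∀ y → y ≤ z → InL z y
    at-z y y≤z = z , ~-refl , y≤z

  zero-not-maximal : IsMinimum → (∃ λ x → x ≢ z) → ¬ Maximal z
  zero-not-maximal minimum (x , x≢z) max-z =
    x≢z (zero-class (max-z x (z , x , ~-refl , ~-refl , minimum x)))

  maximalPart : (Fin n → ℤ) → Fin n → ℤ
  maximalPart μ b = select (Maximal? b) (LSum μ b)

  maximalPart-invariant : ∀ μ → Invariant (maximalPart μ)
  maximalPart-invariant μ {a} {b} a~b = begin
    select (Maximal? a) (LSum μ a)  ≡⟨ cong (select (Maximal? a)) (LSum-invariant μ a~b) ⟩
    select (Maximal? a) (LSum μ b)
      ≡⟨ select-cong (Maximal? a) (Maximal? b) (Maximal-resp a~b) (Maximal-resp (~-sym a~b)) ⟩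
    select (Maximal? b) (LSum μ b)  ∎

  LSum-split : IsMinimum → (∃ λ x → x ≢ z) → ∀ μ → IsMobius μ →
    (∀ a → ¬ Maximal a → ¬ (a ~ z) → LSum μ a ≡ 0ℤ) →
    ∀ a → δ (a ~? z) + maximalPart μ a ≡ LSum μ a
  LSum-split minimum nontrivial μ isMobius hyp a with a ~? z | Maximal? a
  ... | yes a~z | _ with refl ← zero-class a~z = begin
    1ℤ + select (Maximal? z) (LSum μ z)
      ≡⟨ cong (1ℤ +_) (select-no (Maximal? z) (zero-not-maximal minimum nontrivial)) ⟩
    1ℤ                                  ≡⟨ LSum-zero μ isMobius ⟨
    LSum μ z                            ∎
  ... | no _ | yes max-a = trans (ℤ.+-identityˡ _) (select-yes (Maximal? a) max-a)
  ... | no a≁z | no ¬max-a = trans (ℤ.+-identityˡ _)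
    (trans (select-no (Maximal? a) ¬max-a) (sym (hyp a ¬max-a a≁z)))

  μQ+maximalPart≡ClassSum : IsMinimum → (∃ λ x → x ≢ z) → ∀ μ → IsMobius μ →
    (∀ a → ¬ Maximal a → ¬ (a ~ z) → LSum μ a ≡ 0ℤ) →
    ∀ μQ → IsQuotientMobius μQ → ∀ a → μQ a + maximalPart μ a ≡ ClassSum μ a
  μQ+maximalPart≡ClassSum minimum nontrivial μ isMobius hyp μQ (μQ-inv , μQ-sums) =
    LowerSum-injective (λ a~b → cong₂ _+_ (μQ-inv _ _ a~b) (maximalPart-invariant μ a~b))
      (ClassSum-invariant μ) λ a → begin
      LowerSum (λ b → μQ b + maximalPart μ b) a
        ≡⟨ sumWhere-+ (CanonBelow? a) μQ (maximalPart μ) ⟩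
      LowerSum μQ a + LowerSum (maximalPart μ) a
        ≡⟨ cong₂ _+_ (μQ-sums a) (LowerSum-maximal (maximalPart-invariant μ) maximal-supported a) ⟩
      δ (a ~? z) + maximalPart μ a  ≡⟨ LSum-split minimum nontrivial μ isMobius hyp a ⟩
      LSum μ a                      ≡⟨ LowerSum-ClassSum μ a ⟨
      LowerSum (ClassSum μ) a       ∎
    where
    maximal-supported : ∀ b → ¬ Maximal b → maximalPart μ b ≡ 0ℤ
    maximal-supported b = select-no (Maximal? b)

lemma5p1 : (n : ℕ) (_≤_ : Rel (Fin n) 0ℓ) (isPO : IsDecPartialOrder _≡_ _≤_)
    (_~_ : Rel (Fin n) 0ℓ) (isEq : IsDecEquivalence _~_) (z : Fin n) →
    let open QuotientDefs _≤_ isPO _~_ isEq z in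
    IsMinimum →
    (∃ λ x → ¬ (x ≡ z)) →
    IsHomogeneous →
    (μ : Fin n → ℤ) → IsMobius μ →
    (μQ : Fin n → ℤ) → IsQuotientMobius μQ →
    (∀ a → ¬ Maximal a → ¬ (a ~ z) → LSum μ a ≡ 0ℤ) →
    ∀ a → (¬ Maximal a → μQ a ≡ ClassSum μ a) ×
    (Maximal a → μQ a ≡ ClassSum μ a - LSum μ a)
lemma5p1 n _≤_ isPO _~_ isEq z minimum nontrivial homogeneous μ isMobius μQ isQuotientMobius
  hyp a = (λ ¬max-a → trans (μQ≡ClassSum- (select-no (Maximal? a) ¬max-a)) (ℤ.+-identityʳ _))
        , (λ max-a → μQ≡ClassSum- (select-yes (Maximal? a) max-a))
  where
  open QuotientDefs _≤_ isPO _~_ isEq z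
  open HomogeneousQuotient _≤_ isPO _~_ isEq z homogeneous

  μQ+M≡ClassSum : μQ a + maximalPart μ a ≡ ClassSum μ a
  μQ+M≡ClassSum =
    μQ+maximalPart≡ClassSum minimum nontrivial μ isMobius hyp μQ isQuotientMobius a

  μQ≡ClassSum- : ∀ {u} → maximalPart μ a ≡ u → μQ a ≡ ClassSum μ a - u
  μQ≡ClassSum- {u} M≡u = begin
    μQ a                        ≡⟨ //-rightDividesʳ u (μQ a) ⟨
    μQ a + u - u                ≡⟨ cong (λ t → μQ a + t - u) M≡u ⟨
    μQ a + maximalPart μ a - u  ≡⟨ cong (_- u) μQ+M≡ClassSum ⟩
    ClassSum μ a - u            ∎
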